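{- If $M$ is an integral s$\ell$-monoid, then the s$\ell$-monoid $\mathrm{Id}\,F_U(M)$ is cancellative.
   Context: An s$\ell$-monoid is a join semilattice with a monoid structure whose multiplication distributes over binary joins on both sides (ordered by the semilattice order); it is integral if $1$ is the top element; it is cancellative if $ax\leq bx\Rightarrow a\leq b$ and $xa\leq xb\Rightarrow a\leq b$. Construction of $F_U(M)$ for a pomonoid $M$: let $M^*$ be the finite words over $M$ (including the empty word $\varepsilon$) with concatenation $\circ$; for $w=[a_1,\dots,a_n]$ put $\gamma(w)=a_1\cdots a_n$, $\gamma(\varepsilon)=1$. Preorder: $u\sqsubseteq\varepsilon$ iff $u=\varepsilon$; $u\sqsubseteq[b_1,\dots,b_n]$ ($n\geq1$) iff $u=u_1\circ\dots\circ u_n$ with (possibly empty) words $u_i$ satisfying $\gamma(u_i)\leq b_i$. $F_U(M)$ is the set of non-empty words modulo $u\sim v\iff u\sqsubseteq v\sqsubseteq u$, ordered by $\sqsubseteq$, multiplication induced by concatenation, unit the class of $[1]$; it is a pomonoid. For a pomonoid $P$, $\mathrm{Id}\,P$ is the set of non-empty finitely generated downsets of $P$ ordered by inclusion, with join union, multiplication $X\ast Y=\downarrow\{xy:x\in X,y\in Y\}$ and unit $\downarrow 1$. -}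

module Defs where

open import Level using (Level; _⊔_; Lift) renaming (suc to lsuc)
open import Data.Product using (Σ; _×_; _,_; ∃)
open import Data.List using (List; []; _∷_; _++_; foldr)
open import Data.List.NonEmpty using (List⁺; toList) renaming (_⁺++⁺_ to _⁺++⁺_)
open import Data.List.Membership.Propositional using (_∈_)
open import Relation.Binary.PropositionalEquality using (_≡_)
open import Relation.Binary.Lattice.Structures using (IsJoinSemilattice)
open import Relation.Binary.Core using (Rel)
open import Relation.Unary using (Pred; _⊆_)
open import Algebra.Core using (Op₂)
open import Algebra.Structures using (IsMonoid)
open import Algebra.Definitions using (_DistributesOverˡ_; _DistributesOverʳ_)

record SlMonoid c ℓ₁ ℓ₂ : Set (lsuc (c ⊔ ℓ₁ ⊔ ℓ₂)) where
  infix  4 _≈_ _≤_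
  infixr 6 _∨_
  infixl 7 _·_
  field
    Carrier           : Set c
    _≈_               : Rel Carrier ℓ₁
    _≤_               : Rel Carrier ℓ₂
    _∨_               : Op₂ Carrier
    _·_               : Op₂ Carrier
    e                 : Carrier
    isJoinSemilattice : IsJoinSemilattice _≈_ _≤_ _∨_
    isMonoid          : IsMonoid _≈_ _·_ e
    distribˡ          : _DistributesOverˡ_ _≈_ _·_ _∨_
    distribʳ          : _DistributesOverʳ_ _≈_ _·_ _∨_

Integral : ∀ {c ℓ₁ ℓ₂} → SlMonoid c ℓ₁ ℓ₂ → Set (c ⊔ ℓ₂)
Integral M = ∀ a → a ≤ e
  where open SlMonoid M

-- The pomonoid F_U(M), presented by non-empty words with the preorder ⊑
-- (the quotient by ⊑ ∩ ⊒ is left implicit: downsets w.r.t. the preorder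
-- are exactly the downsets of the quotient poset).

module FU {c ℓ₁ ℓ₂} (M : SlMonoid c ℓ₁ ℓ₂) where
  open SlMonoid M

  γ : List Carrier → Carrier
  γ = foldr _·_ e

  -- u ⊑ ε iff u = ε ;
  -- u ⊑ b ∷ bs iff u = u₁ ++ w with γ u₁ ≤ b and w ⊑ bs
  -- (this is u = u₁ ∘ ⋯ ∘ uₙ with γ uᵢ ≤ bᵢ, unfolded recursively)
  _⊑_ : List Carrier → List Carrier → Set (c ⊔ ℓ₂)
  u ⊑ []       = Lift ℓ₂ (u ≡ [])
  u ⊑ (b ∷ bs) = Σ (List Carrier) λ u₁ → Σ (List Carrier) λ w →
                   (u ≡ u₁ ++ w) × (γ u₁ ≤ b) × (w ⊑ bs)

  W : Set c
  W = List⁺ Carrier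

  _≤W_ : W → W → Set (c ⊔ ℓ₂)
  u ≤W v = toList u ⊑ toList v

  _∙W_ : W → W → W
  u ∙W v = u ⁺++⁺ v

  -- Id F_U(M): non-empty finitely generated downsets.

  ↓_ : List⁺ W → Pred W (c ⊔ ℓ₂)
  (↓ G) w = Σ W λ g → (g ∈ toList G) × (w ≤W g)

  _∗_ : Pred W (c ⊔ ℓ₂) → Pred W (c ⊔ ℓ₂) → Pred W (c ⊔ ℓ₂)
  (X ∗ Y) w = Σ W λ x → Σ W λ y → X x × Y y × (w ≤W (x ∙W y))

  IdCancellative : Set (c ⊔ ℓ₂)
  IdCancellative =
    (∀ (A B X : List⁺ W) → ((↓ A) ∗ (↓ X)) ⊆ ((↓ B) ∗ (↓ X)) → (↓ A) ⊆ (↓ B)) ×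
    (∀ (A B X : List⁺ W) → ((↓ X) ∗ (↓ A)) ⊆ ((↓ X) ∗ (↓ B)) → (↓ A) ⊆ (↓ B))

{-# OPTIONS --safe #-}
module Submission where

-- Let w ∈ ↓A and x ∈ ↓X.  By hypothesis w x ⊑ b y with b ∈ ↓B and y ∈ ↓X, so
-- w x splits as u₁ u₂ with u₁ ⊑ b and u₂ ⊑ y.  Either u₁ is a prefix of w, and
-- then w ⊑ b because in an integral sℓ-monoid appending letters only lowers a
-- word; or u₁ swallows w and a non-empty head of x, and then the strictly
-- shorter suffix u₂ of x again lies in ↓X.  Descending on the length of x, the
-- second alternative cannot go on forever: once x is empty, [e] ∈ ↓X, and
-- w [e] ⊑ b y leaves just the first alternative or u₁ = w [e], where
-- w ⊑ w [e] ⊑ b.  Left cancellation is the mirror image.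

open import Defs
open import Level using (_⊔_; lift)
open import Function using (_on_)
open import Data.Nat using (_<_; s≤s)
open import Data.Nat.Induction using (<-wellFounded)
open import Data.Product using (Σ; ∃; ∃₂; _×_; _,_)
open import Data.Sum using (_⊎_; inj₁; inj₂)
open import Data.List using (List; []; _∷_; _++_; length)
open import Data.List.Properties
  using (∷-injective; ++-assoc; ++-identityʳ; length-++-≤ˡ; length-++-≤ʳ; length-++-sucʳ)
open import Data.List.NonEmpty using (List⁺; toList; head; [_]) renaming (_∷_ to _∷⁺_)
open import Data.List.Membership.Propositional using (_∈_)
open import Data.List.Relation.Unary.Any using (here)
open import Induction.WellFounded using (Acc; acc)
import Relation.Binary.Construct.On as On
open import Relation.Binary.Bundles using (Poset)
open import Relation.Binary.Lattice.Bundles using (JoinSemilattice)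
open import Relation.Binary.Lattice.Structures using (IsJoinSemilattice)
import Relation.Binary.Lattice.Properties.JoinSemilattice as JoinSemilatticeProperties
import Relation.Binary.Reasoning.PartialOrder as PartialOrderReasoning
open import Relation.Binary.PropositionalEquality using (_≡_; refl; sym; trans; cong; subst)
open import Relation.Unary using (_⊆_)
open import Algebra.Structures using (IsMonoid)

module _ {a} {A : Set a} where

  ++-≡-++-split : ∀ (w x u v : List A) → w ++ x ≡ u ++ v →
                  (∃ λ r → w ≡ u ++ r × v ≡ r ++ x) ⊎
                  (Σ A λ c → ∃ λ r → u ≡ w ++ c ∷ r × x ≡ c ∷ r ++ v)
  ++-≡-++-split []      x []      v eq = inj₁ ([] , refl , sym eq)
  ++-≡-++-split []      x (c ∷ u) v eq = inj₂ (c , u , refl , eq)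
  ++-≡-++-split (d ∷ w) x []      v eq = inj₁ (d ∷ w , refl , sym eq)
  ++-≡-++-split (d ∷ w) x (c ∷ u) v eq with ∷-injective eq
  ... | refl , eq′ with ++-≡-++-split w x u v eq′
  ...   | inj₁ (r , p , q)      = inj₁ (r , cong (d ∷_) p , q)
  ...   | inj₂ (c′ , r , p , q) = inj₂ (c′ , r , cong (d ∷_) p , q)

  length-++-<ˡ : ∀ p (a : A) s → length p < length (p ++ a ∷ s)
  length-++-<ˡ p a s = subst (length p <_) (sym (length-++-sucʳ p a s)) (s≤s (length-++-≤ˡ p))

  length-∷-++-<ʳ : ∀ (a : A) p s → length s < length (a ∷ p ++ s)
  length-∷-++-<ʳ a p s = s≤s (length-++-≤ʳ s {p})

  descend : ∀ {p q} (D : List A → Set p) {G : Set q} →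
            (∀ x → D x → G ⊎ ∃ λ s → length s < length x × D s) →
            ∀ x → D x → G
  descend D {G} step x = go x (On.wellFounded length <-wellFounded x)
    where
    go : ∀ x → Acc (_<_ on length) x → D x → G
    go x (acc rs) Dx with step x Dx
    ... | inj₁ g              = g
    ... | inj₂ (s , s<x , Ds) = go s (rs s<x) Ds

module _ {c ℓ₁ ℓ₂} (M : SlMonoid c ℓ₁ ℓ₂) where
  open SlMonoid M
  open FU M
  private
    module L = IsJoinSemilattice isJoinSemilattice
    module Mon = IsMonoid isMonoid
    poset : Poset c ℓ₁ ℓ₂
    poset = record { isPartialOrder = L.isPartialOrder }
    joinSemilattice : JoinSemilattice c ℓ₁ ℓ₂
    joinSemilattice = record { isJoinSemilattice = isJoinSemilattice }
  open PartialOrderReasoning poset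
  open JoinSemilatticeProperties joinSemilattice using (x≤y⇒x∨y≈y)

  ·-monoˡ-≤ : ∀ d {a b} → a ≤ b → d · a ≤ d · b
  ·-monoˡ-≤ d {a} {b} a≤b = begin
    d · a         ≤⟨ L.x≤x∨y (d · a) (d · b) ⟩
    d · a ∨ d · b ≈⟨ L.Eq.sym (distribˡ d a b) ⟩
    d · (a ∨ b)   ≈⟨ Mon.∙-congˡ (x≤y⇒x∨y≈y a≤b) ⟩
    d · b         ∎

  ·-monoʳ-≤ : ∀ d {a b} → a ≤ b → a · d ≤ b · d
  ·-monoʳ-≤ d {a} {b} a≤b = begin
    a · d         ≤⟨ L.x≤x∨y (a · d) (b · d) ⟩
    a · d ∨ b · d ≈⟨ L.Eq.sym (distribʳ d a b) ⟩
    (a ∨ b) · d   ≈⟨ Mon.∙-congʳ (x≤y⇒x∨y≈y a≤b) ⟩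
    b · d         ∎

  γ-++ : ∀ u v → γ (u ++ v) ≈ γ u · γ v
  γ-++ []      v = L.Eq.sym (Mon.identityˡ (γ v))
  γ-++ (a ∷ u) v = L.Eq.trans (Mon.∙-congˡ (γ-++ u v)) (L.Eq.sym (Mon.assoc a (γ u) (γ v)))

  γ-mono : ∀ {u v} → u ⊑ v → γ u ≤ γ v
  γ-mono {v = []}     (lift refl) = L.refl
  γ-mono {v = b ∷ v} (u₁ , w , refl , γu₁≤b , w⊑v) = begin
    γ (u₁ ++ w)  ≈⟨ γ-++ u₁ w ⟩
    γ u₁ · γ w   ≤⟨ ·-monoʳ-≤ (γ w) γu₁≤b ⟩
    b · γ w      ≤⟨ ·-monoˡ-≤ b (γ-mono w⊑v) ⟩
    b · γ v      ∎

  ⊑-refl : ∀ u → u ⊑ u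
  ⊑-refl []      = lift refl
  ⊑-refl (a ∷ u) = a ∷ [] , u , refl , L.reflexive (Mon.identityʳ a) , ⊑-refl u

  ⊑-++⁻ : ∀ {u} v {v′} → u ⊑ (v ++ v′) →
          ∃₂ λ u₁ u₂ → u ≡ u₁ ++ u₂ × u₁ ⊑ v × u₂ ⊑ v′
  ⊑-++⁻ {u} []      u⊑v′ = [] , u , refl , lift refl , u⊑v′
  ⊑-++⁻     (b ∷ v) (u₁ , w , refl , γu₁≤b , w⊑vv′) with ⊑-++⁻ v w⊑vv′
  ... | w₁ , w₂ , refl , w₁⊑v , w₂⊑v′ =
    u₁ ++ w₁ , w₂ , sym (++-assoc u₁ w₁ w₂) , (u₁ , w₁ , refl , γu₁≤b , w₁⊑v) , w₂⊑v′

  ⊑-++⁺ : ∀ {u u′ v v′} → u ⊑ v → u′ ⊑ v′ → (u ++ u′) ⊑ (v ++ v′)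
  ⊑-++⁺ {v = []}    (lift refl)                    u′⊑v′ = u′⊑v′
  ⊑-++⁺ {v = b ∷ v} (u₁ , w , refl , γu₁≤b , w⊑v) u′⊑v′ =
    u₁ , _ , ++-assoc u₁ w _ , γu₁≤b , ⊑-++⁺ w⊑v u′⊑v′

  ⊑-trans : ∀ {u v t} → u ⊑ v → v ⊑ t → u ⊑ t
  ⊑-trans {t = []}    u⊑[] (lift refl) = u⊑[]
  ⊑-trans {t = d ∷ t} u⊑v (v₁ , v₂ , refl , γv₁≤d , v₂⊑t) with ⊑-++⁻ v₁ u⊑v
  ... | u₁ , u₂ , refl , u₁⊑v₁ , u₂⊑v₂ =
    u₁ , u₂ , refl , L.trans (γ-mono u₁⊑v₁) γv₁≤d , ⊑-trans u₂⊑v₂ v₂⊑t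

  []⊑⇒[e]⊑ : ∀ {b bs} → [] ⊑ (b ∷ bs) → (e ∷ []) ⊑ (b ∷ bs)
  []⊑⇒[e]⊑ ([] , [] , refl , e≤b , []⊑bs) =
    e ∷ [] , [] , refl , L.trans (L.reflexive (Mon.identityʳ e)) e≤b , []⊑bs

  []⊑[e] : [] ⊑ (e ∷ [])
  []⊑[e] = [] , [] , refl , L.refl , lift refl

  ⊑-∷ʳ-e : ∀ u → u ⊑ (u ++ e ∷ [])
  ⊑-∷ʳ-e u = subst (_⊑ (u ++ e ∷ [])) (++-identityʳ u) (⊑-++⁺ (⊑-refl u) []⊑[e])

  ⊑-e-∷ : ∀ u → u ⊑ (e ∷ u)
  ⊑-e-∷ u = ⊑-++⁺ {u = []} []⊑[e] (⊑-refl u)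

  -- ↓ G on all words, the empty one included, so that the descent may reach it.
  _∈↓_ : List Carrier → List⁺ W → Set (c ⊔ ℓ₂)
  u ∈↓ G = Σ W λ g → g ∈ toList G × u ⊑ toList g

  ∈↓-⊑-closed : ∀ {u v G} → u ⊑ v → v ∈↓ G → u ∈↓ G
  ∈↓-⊑-closed u⊑v (g , g∈G , v⊑g) = g , g∈G , ⊑-trans u⊑v v⊑g

  head-∈↓ : ∀ G → toList (head G) ∈↓ G
  head-∈↓ G = head G , here refl , ⊑-refl _

  []∈↓⇒[e]∈↓ : ∀ {G} → [] ∈↓ G → (e ∷ []) ∈↓ G
  []∈↓⇒[e]∈↓ (g , g∈G , []⊑g) = g , g∈G , []⊑⇒[e]⊑ []⊑g

  module _ (integral : Integral M) where

    γ-++-≤ˡ : ∀ u v → γ (u ++ v) ≤ γ u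
    γ-++-≤ˡ u v = begin
      γ (u ++ v)  ≈⟨ γ-++ u v ⟩
      γ u · γ v   ≤⟨ ·-monoˡ-≤ (γ u) (integral (γ v)) ⟩
      γ u · e     ≈⟨ Mon.identityʳ (γ u) ⟩
      γ u         ∎

    γ-++-≤ʳ : ∀ u v → γ (u ++ v) ≤ γ v
    γ-++-≤ʳ u v = begin
      γ (u ++ v)  ≈⟨ γ-++ u v ⟩
      γ u · γ v   ≤⟨ ·-monoʳ-≤ (γ v) (integral (γ u)) ⟩
      e · γ v     ≈⟨ Mon.identityˡ (γ v) ⟩
      γ v         ∎

    ⊑-++-extendʳ : ∀ {u b bs} z → u ⊑ (b ∷ bs) → (u ++ z) ⊑ (b ∷ bs)
    ⊑-++-extendʳ {bs = []}     z (u₁ , [] , refl , γu₁≤b , lift refl) =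
      u₁ ++ z , [] , trans (++-assoc u₁ [] z) (sym (++-identityʳ (u₁ ++ z))) ,
      L.trans (γ-++-≤ˡ u₁ z) γu₁≤b , lift refl
    ⊑-++-extendʳ {bs = _ ∷ _} z (u₁ , w , refl , γu₁≤b , w⊑bs) =
      u₁ , w ++ z , ++-assoc u₁ w z , γu₁≤b , ⊑-++-extendʳ z w⊑bs

    ⊑-++-extendˡ : ∀ {u b bs} r → u ⊑ (b ∷ bs) → (r ++ u) ⊑ (b ∷ bs)
    ⊑-++-extendˡ r (u₁ , w , refl , γu₁≤b , w⊑bs) =
      r ++ u₁ , w , sym (++-assoc r u₁ w) , L.trans (γ-++-≤ʳ r u₁) γu₁≤b , w⊑bs

    split-⊑-++ʳ : ∀ w {x} (b : W) {y} → (w ++ x) ⊑ (toList b ++ y) →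
                  w ⊑ toList b ⊎
                  (Σ Carrier λ a → ∃₂ λ p s → x ≡ a ∷ p ++ s × (w ++ a ∷ p) ⊑ toList b × s ⊑ y)
    split-⊑-++ʳ w {x} b wx⊑by with ⊑-++⁻ (toList b) wx⊑by
    ... | u₁ , u₂ , eq , u₁⊑b , u₂⊑y with ++-≡-++-split w x u₁ u₂ eq
    ...   | inj₁ (r , refl , _)      = inj₁ (⊑-++-extendʳ r u₁⊑b)
    ...   | inj₂ (a , p , refl , x≡) = inj₂ (a , p , u₂ , x≡ , u₁⊑b , u₂⊑y)

    split-⊑-++ˡ : ∀ x {w} y (b : W) → (x ++ w) ⊑ (y ++ toList b) →
                  w ⊑ toList b ⊎
                  (∃ λ p → Σ Carrier λ a → ∃ λ s → x ≡ p ++ a ∷ s × p ⊑ y × (a ∷ s ++ w) ⊑ toList b)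
    split-⊑-++ˡ x {w} y b xw⊑yb with ⊑-++⁻ y xw⊑yb
    ... | u₁ , u₂ , eq , u₁⊑y , u₂⊑b with ++-≡-++-split x w u₁ u₂ eq
    ...   | inj₁ ([] , _ , refl)     = inj₁ u₂⊑b
    ...   | inj₁ (a ∷ s , x≡ , refl) = inj₂ (u₁ , a , s , x≡ , u₁⊑y , u₂⊑b)
    ...   | inj₂ (a , r , _ , refl)  = inj₁ (⊑-++-extendˡ (a ∷ r) u₂⊑b)

    ∗-cancelʳ : ∀ A B X → ((↓ A) ∗ (↓ X)) ⊆ ((↓ B) ∗ (↓ X)) → (↓ A) ⊆ (↓ B)
    ∗-cancelʳ A B X AX⊆BX {w} w∈A = descend (_∈↓ X) step (toList (head X)) (head-∈↓ X)
      where
      step : ∀ x → x ∈↓ X → toList w ∈↓ B ⊎ ∃ λ s → length s < length x × s ∈↓ X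
      step [] []∈X with AX⊆BX (w , [ e ] , w∈A , []∈↓⇒[e]∈↓ []∈X , ⊑-refl _)
      ... | b , _ , b∈B , _ , we⊑by with split-⊑-++ʳ (toList w) b we⊑by
      ...   | inj₁ w⊑b = inj₁ (∈↓-⊑-closed w⊑b b∈B)
      ...   | inj₂ (_ , [] , [] , refl , we⊑b , _) =
              inj₁ (∈↓-⊑-closed (⊑-trans (⊑-∷ʳ-e (toList w)) we⊑b) b∈B)
      ...   | inj₂ (_ , [] , _ ∷ _ , () , _)
      ...   | inj₂ (_ , _ ∷ _ , _ , () , _)
      step (a ∷ x) ax∈X with AX⊆BX (w , a ∷⁺ x , w∈A , ax∈X , ⊑-refl _)
      ... | b , y , b∈B , y∈X , wx⊑by with split-⊑-++ʳ (toList w) b wx⊑by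
      ...   | inj₁ w⊑b = inj₁ (∈↓-⊑-closed w⊑b b∈B)
      ...   | inj₂ (c , p , s , ax≡ , _ , s⊑y) =
              inj₂ (s , subst (λ z → length s < length z) (sym ax≡) (length-∷-++-<ʳ c p s) ,
                    ∈↓-⊑-closed s⊑y y∈X)

    ∗-cancelˡ : ∀ A B X → ((↓ X) ∗ (↓ A)) ⊆ ((↓ X) ∗ (↓ B)) → (↓ A) ⊆ (↓ B)
    ∗-cancelˡ A B X XA⊆XB {w} w∈A = descend (_∈↓ X) step (toList (head X)) (head-∈↓ X)
      where
      step : ∀ x → x ∈↓ X → toList w ∈↓ B ⊎ ∃ λ p → length p < length x × p ∈↓ X
      step [] []∈X with XA⊆XB ([ e ] , w , []∈↓⇒[e]∈↓ []∈X , w∈A , ⊑-refl _)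
      ... | y , b , _ , b∈B , ew⊑yb with split-⊑-++ˡ (e ∷ []) (toList y) b ew⊑yb
      ...   | inj₁ w⊑b = inj₁ (∈↓-⊑-closed w⊑b b∈B)
      ...   | inj₂ ([] , _ , [] , refl , _ , ew⊑b) =
              inj₁ (∈↓-⊑-closed (⊑-trans (⊑-e-∷ (toList w)) ew⊑b) b∈B)
      ...   | inj₂ ([] , _ , _ ∷ _ , () , _)
      ...   | inj₂ (_ ∷ [] , _ , _ , () , _)
      ...   | inj₂ (_ ∷ _ ∷ _ , _ , _ , () , _)
      step (a ∷ x) ax∈X with XA⊆XB (a ∷⁺ x , w , ax∈X , w∈A , ⊑-refl _)
      ... | y , b , y∈X , b∈B , xw⊑yb with split-⊑-++ˡ (a ∷ x) (toList y) b xw⊑yb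
      ...   | inj₁ w⊑b = inj₁ (∈↓-⊑-closed w⊑b b∈B)
      ...   | inj₂ (p , c , s , ax≡ , p⊑y , _) =
              inj₂ (p , subst (λ z → length p < length z) (sym ax≡) (length-++-<ˡ p c s) ,
                    ∈↓-⊑-closed p⊑y y∈X)

mainTheorem17 : ∀ {c ℓ₁ ℓ₂} (M : SlMonoid c ℓ₁ ℓ₂) → Integral M → FU.IdCancellative M
mainTheorem17 M integral = ∗-cancelʳ M integral , ∗-cancelˡ M integral
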